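{- Let $n\ge4$, $\mathbf{z}\in\mathcal{V}^{\bullet}_n$ and $I=[\mathbf{0},\mathbf{z}]$. Suppose that for every $\mathbf{y}\in\mathcal{V}^{\bullet}_n$ with $\mathrm{rk}(\mathbf{y})<\mathrm{rk}(\mathbf{z})$ the following all hold for the interval $J=[\mathbf{0},\mathbf{y}]$: for every positive $k\le|A^{all}|$, $J\langle A^L_k\cap J\rangle$ is (L)-shellable and $J\langle A^S_k\cap J\rangle$ is (S)-shellable whenever the respective atom set is nonempty; and for every $\ell\in[n-1]$ and positive $k\le|A^{(\ell+1)}|$, $J\langle A^{(\ell+1)}_k\cap J\rangle$ is (L)-shellable. Then $I\langle A^L_1\cap I\rangle$ is (L)-shellable and $I\langle A^S_1\cap I\rangle$ is (S)-shellable, whenever these atom sets are nonempty.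
   Context: $\mathbf{j}=(1,\dots,1)$. $(\mathcal{V}^{\bullet}_n,\preceq)$ has ground set $\{\mathbf{a}\in\mathbb{N}_0^n:\text{coordinate sum divisible by }n,\ \mathbf{a}\neq\mathbf{j}\}$ with $\mathbf{a}\preceq\mathbf{b}$ iff $\mathbf{a}\le\mathbf{b}$ coordinatewise and $\mathbf{b}-\mathbf{a}\neq\mathbf{j}$; $\mathrm{rk}(\mathbf{y})$ is the rank of $\mathbf{y}$ in this graded poset (the coordinate sum of $\mathbf{y}$ divided by $n$). $A^{all}$: atoms of $\mathcal{V}^{\bullet}_n$ (vectors with coordinate sum $n$ other than $\mathbf{j}$). $A^{(\ell)}=\{(\xi_1,\dots,\xi_n)\in A^{all}:(\xi_\ell,\dots,\xi_n)\ne \mathbf{0}\}$. $<^L$: lexicographic order on $A^{all}$. With $\mathbf{u}_0=(1,\dots,1,0,2)$ and $A^S=A^{(n)}\setminus\{\mathbf{u}_0\}$, $<^S$ lists $A^S$ in $<^L$ order, then $\mathbf{u}_0$, then $A^{all}\setminus A^{(n)}$ in $<^L$ order. $A^L_k$, $A^S_k$: the $k$ smallest elements of $A^{all}$ in $<^L$, resp. $<^S$; $A^{(\ell)}_k$: the $k$ smallest elements of $A^{(\ell)}$ in $<^L$. For an interval $J$ with minimum $\mathbf{0}$ and a set $B$ of atoms in $J$, $J\langle B\rangle$ is the induced subposet on $\{\mathbf{0}\}\cup\{\mathbf{b}\in J:\mathbf{b}\succeq\mathbf{a}\text{ for some }\mathbf{a}\in B\}$; $B\cap J$ denotes atoms of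 $B$ lying in $J$. A shelling order is an order of maximal chains such that whenever $c'$ precedes $c$ there is $c^*$ preceding $c$ with $c\cap c^*\supseteq c\cap c'$, $|c\,\Delta\,c^*|=2$. $J\langle B\rangle$ is (L)-shellable (resp. (S)-shellable) if it has a shelling order in which $c'$ precedes $c$ whenever the atom of $c'$ is strictly smaller than that of $c$ in $<^L$ (resp. $<^S$). -}

module Defs where

open import Data.Nat using (ℕ; zero; suc; _+_; _∸_; _≤_; _<_; _<ᵇ_; _≡ᵇ_; _≤ᵇ_; _/_)
open import Data.Nat.Properties using (_≟_)
open import Data.Nat.Divisibility using (_∣?_)
open import Data.Bool using (Bool; true; false; _∧_; _∨_; not; T; if_then_else_)
open import Data.Fin using (Fin; toℕ)
open import Data.Vec using (Vec; []; _∷_; replicate; zipWith; tabulate; sum; toList; foldr)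
import Data.Vec.Properties as VP
open import Data.List using (List; []; _∷_; length; filterᵇ; concatMap; map; upTo; allFin; lookup)
open import Data.List.Relation.Unary.Unique.Propositional using (Unique)
open import Data.List.Relation.Unary.AllPairs using (AllPairs)
open import Data.List.Membership.Propositional using (_∈_)
open import Data.Bool.ListAction using (any)
open import Data.Maybe using (Maybe; just; nothing)
open import Data.Product using (Σ; ∃; _×_; _,_)
open import Data.Sum using (_⊎_)
open import Relation.Binary.PropositionalEquality using (_≡_; _≢_)
open import Relation.Nullary.Decidable using (⌊_⌋; ¬?)
open import Relation.Binary using (DecidableEquality)

V : ℕ → Set
V n = Vec ℕ n

_≟V_ : ∀ {n} → DecidableEquality (V n)
_≟V_ = VP.≡-dec _≟_

eqV : ∀ {n} → V n → V n → Bool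
eqV a b = ⌊ a ≟V b ⌋

𝟎 : (n : ℕ) → V n
𝟎 n = replicate n 0

𝐣 : (n : ℕ) → V n
𝐣 n = replicate n 1

leqPW : ∀ {m} → V m → V m → Bool
leqPW [] [] = true
leqPW (x ∷ xs) (y ∷ ys) = (x ≤ᵇ y) ∧ leqPW xs ys

inV : (n : ℕ) → V n → Bool
inV n a = ⌊ n ∣? sum a ⌋ ∧ not (eqV a (𝐣 n))

leq : (n : ℕ) → V n → V n → Bool
leq n a b = leqPW a b ∧ not (eqV (zipWith _∸_ b a) (𝐣 n))

strictLt : (n : ℕ) → V n → V n → Set
strictLt n a b = T (leq n a b) × a ≢ b

rk : (n : ℕ) → V n → ℕ
rk zero    y = 0
rk (suc m) y = sum y / suc m

boxVecs : (m b : ℕ) → List (V m)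
boxVecs zero    b = [] ∷ []
boxVecs (suc m) b = concatMap (λ x → map (x ∷_) (boxVecs m b)) (upTo (suc b))

isAtom : (n : ℕ) → V n → Bool
isAtom n a = (sum a ≡ᵇ n) ∧ not (eqV a (𝐣 n))

-- the finite list of all atoms A^all (each entry of an atom is ≤ n)
atomList : (n : ℕ) → List (V n)
atomList n = filterᵇ (isAtom n) (boxVecs n n)

ltL : ∀ {m} → V m → V m → Bool
ltL [] [] = false
ltL (x ∷ xs) (y ∷ ys) = (x <ᵇ y) ∨ ((x ≡ᵇ y) ∧ ltL xs ys)

-- (ξ_ℓ,…,ξ_n) ≠ 0   (ℓ is 1-indexed)
tailNZ : (n : ℕ) → ℕ → V n → Bool
tailNZ n ℓ a = any (λ i → (ℓ ≤ᵇ suc (toℕ i)) ∧ not (Data.Vec.lookup a i ≡ᵇ 0)) (allFin n)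
  where import Data.Vec

inAℓ : (n ℓ : ℕ) → V n → Bool
inAℓ n ℓ a = isAtom n a ∧ tailNZ n ℓ a

-- u0 = (1,…,1,0,2)
u0 : (n : ℕ) → V n
u0 n = tabulate (λ i → if suc (toℕ i) ≡ᵇ n then 2
                       else if suc (suc (toℕ i)) ≡ᵇ n then 0 else 1)

inAS : (n : ℕ) → V n → Bool
inAS n a = inAℓ n n a ∧ not (eqV a (u0 n))

-- block of an atom in <^S: A^S first, then u0, then A^all ∖ A^(n)
sBlock : (n : ℕ) → V n → ℕ
sBlock n a = if inAS n a then 0 else if eqV a (u0 n) then 1 else 2

ltS : (n : ℕ) → V n → V n → Bool
ltS n a b = (sBlock n a <ᵇ sBlock n b) ∨ ((sBlock n a ≡ᵇ sBlock n b) ∧ ltL a b)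

countBelow : (n : ℕ) → (V n → Bool) → (V n → V n → Bool) → V n → ℕ
countBelow n p lt a = length (filterᵇ (λ b → p b ∧ lt b a) (atomList n))

-- A^L_k, A^S_k, A^(ℓ)_k : the k smallest elements
AL : (n k : ℕ) → V n → Bool
AL n k a = isAtom n a ∧ (countBelow n (λ _ → true) ltL a <ᵇ k)

AS : (n k : ℕ) → V n → Bool
AS n k a = isAtom n a ∧ (countBelow n (λ _ → true) (ltS n) a <ᵇ k)

Aℓk : (n ℓ k : ℕ) → V n → Bool
Aℓk n ℓ k a = inAℓ n ℓ a ∧ (countBelow n (inAℓ n ℓ) ltL a <ᵇ k)

card-Aall : ℕ → ℕ
card-Aall n = length (atomList n)

card-Aℓ : ℕ → ℕ → ℕ
card-Aℓ n ℓ = length (filterᵇ (tailNZ n ℓ) (atomList n))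

inI : (n : ℕ) → V n → V n → Set
inI n y x = T (inV n x) × T (leq n (𝟎 n) x) × T (leq n x y)

-- x ∈ J⟨B ∩ J⟩ for J = [0,y]
inSub : (n : ℕ) → V n → (V n → Bool) → V n → Set
inSub n y B x = x ≡ 𝟎 n ⊎ (inI n y x × ∃ λ a → T (B a) × inI n y a × T (leq n a x))

NonEmptyAt : (n : ℕ) → V n → (V n → Bool) → Set
NonEmptyAt n y B = ∃ λ a → T (B a) × inI n y a

module _ {n : ℕ} (P : V n → Set) (_≺_ : V n → V n → Set) where

  Chain : List (V n) → Set
  Chain c = (∀ x → x ∈ c → P x) × AllPairs _≺_ c

  MaxChain : List (V n) → Set
  MaxChain c = Chain c × (∀ x → P x → (∀ y → y ∈ c → (x ≺ y) ⊎ (y ≺ x)) → x ∈ c)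

  symDiffSize : List (V n) → List (V n) → ℕ
  symDiffSize c d = length (filterᵇ (λ x → not ⌊ x ∈? d ⌋) c)
                  + length (filterᵇ (λ x → not ⌊ x ∈? c ⌋) d)
    where open import Data.List.Membership.DecPropositional (_≟V_ {n}) using (_∈?_)

  ShellingOrder : List (List (V n)) → Set
  ShellingOrder L =
      (∀ c → c ∈ L → MaxChain c)
    × (∀ c → MaxChain c → c ∈ L)
    × Unique L
    × (∀ (i j : Fin (length L)) → toℕ i < toℕ j →
         Σ (Fin (length L)) λ k → toℕ k < toℕ j
           × (∀ x → x ∈ lookup L j → x ∈ lookup L i → x ∈ lookup L k)
           × symDiffSize (lookup L j) (lookup L k) ≡ 2)

  -- the atom of a chain 0 ≺ a ≺ …
  atomOf : List (V n) → Maybe (V n)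
  atomOf (_ ∷ a ∷ _) = just a
  atomOf _           = nothing

  ShellableWrt : (V n → V n → Bool) → Set
  ShellableWrt lt = ∃ λ L → ShellingOrder L
    × (∀ (i j : Fin (length L)) (a' a : V n) →
         atomOf (lookup L i) ≡ just a' → atomOf (lookup L j) ≡ just a →
         T (lt a' a) → toℕ i < toℕ j)

LShellable : (n : ℕ) → V n → (V n → Bool) → Set
LShellable n y B = ShellableWrt (inSub n y B) (strictLt n) ltL

SShellable : (n : ℕ) → V n → (V n → Bool) → Set
SShellable n y B = ShellableWrt (inSub n y B) (strictLt n) (ltS n)

-- For n ≥ 3 the lexicographically first atom 𝐚 = (0,…,0,n) lies in A^S (it differs from u0),
-- so A^L_1 = A^S_1 = {𝐚} and I⟨{𝐚}⟩ is 𝟎 together with [𝐚, z].  Translation by 𝐚 identifies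
-- [𝐚, z] with J = [𝟎, z − 𝐚], whose top has smaller rank.  Since every nonzero element of V•_n
-- lies above an atom (this needs n ≥ 3), J = J⟨A^all ∩ J⟩, which is (L)-shellable by
-- hypothesis.  Putting 𝟎 under the translated chains gives a shelling of I⟨{𝐚}⟩ in which every
-- maximal chain has the atom 𝐚, so compatibility with any atom order holds vacuously.

module Submission where

open import Defs
open import Data.Nat
open import Data.Nat.Properties
open import Data.Nat.DivMod using (_/_; m/n≡1+[m∸n]/n)
open import Data.Nat.Divisibility using (_∣_; divides; _∣?_; ∣-refl; ∣m∣n⇒∣m+n; ∣m+n∣m⇒∣n)
open import Data.Bool using (Bool; true; false; _∧_; _∨_; not; T; if_then_else_)
open import Data.Bool.Properties using (T-∨; T-≡)
open import Data.Fin using (Fin; toℕ; zero; suc; fromℕ; cast)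
open import Data.Fin.Properties using (toℕ-fromℕ; toℕ-cast; cast-involutive)
open import Data.Vec as Vec using (Vec; []; _∷_; zipWith; sum)
open import Data.Vec.Properties using (lookup-replicate; lookup∘tabulate)
open import Data.List using (List; []; _∷_; length; filterᵇ; map; lookup)
open import Data.List.Properties using (filter-notAll; filter-some; length-map; map-injective; ∷-injectiveʳ)
open import Data.List.Membership.Propositional using (_∈_; lose)
open import Data.List.Membership.Propositional.Properties
  using (∈-map⁺; ∈-map⁻; ∈-concatMap⁺; ∈-upTo⁺; ∈-filter⁺; ∈-allFin; ∈-lookup)
open import Data.List.Relation.Unary.Any using (here; there)
import Data.List.Relation.Unary.Any as Any
open import Data.List.Relation.Unary.Any.Properties using (any⁺)
import Data.List.Relation.Unary.All as All
import Data.List.Relation.Unary.All.Properties as All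
open import Data.List.Relation.Unary.AllPairs as AllPairs using (AllPairs; []; _∷_)
import Data.List.Relation.Unary.AllPairs.Properties as AllPairs
import Data.List.Relation.Unary.Unique.Propositional.Properties as Unique
open import Data.Maybe using (just)
open import Data.Maybe.Properties using (just-injective)
open import Data.Product using (Σ; ∃; _×_; _,_; proj₁; proj₂; swap)
open import Data.Sum using (_⊎_; inj₁; inj₂)
open import Data.Empty using (⊥; ⊥-elim)
open import Data.Unit using (tt)
open import Function using (_∘_)
open import Function.Bundles using (Equivalence)
open import Relation.Nullary using (¬_; yes; no)
open import Relation.Nullary.Decidable using (⌊_⌋; T?; toWitness; fromWitness)
open import Relation.Unary using (_≐_)
open import Relation.Binary.PropositionalEquality
open import Algebra.Properties.CommutativeSemigroup +-commutativeSemigroup using ()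
  renaming (interchange to +-interchange; x∙yz≈y∙xz to x+[y+z]≡y+[x+z])

∧-intro : ∀ {a b} → T a → T b → T (a ∧ b)
∧-intro {true} {true} _ _ = tt

∧-elimˡ : ∀ {a b} → T (a ∧ b) → T a
∧-elimˡ {true} _ = tt

∧-elimʳ : ∀ {a b} → T (a ∧ b) → T b
∧-elimʳ {true} p = p

not-eqV⇒≢ : ∀ {m} {u v : V m} → T (not (eqV u v)) → u ≢ v
not-eqV⇒≢ {u = u} {v} p e with u ≟V v
... | yes _ = p
... | no u≢v = u≢v e

≢⇒not-eqV : ∀ {m} {u v : V m} → u ≢ v → T (not (eqV u v))
≢⇒not-eqV {u = u} {v} u≢v with u ≟V v
... | yes e = u≢v e
... | no _ = tt

infixl 6 _⊕_ _⊖_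

_⊕_ : ∀ {m} → V m → V m → V m
_⊕_ = zipWith _+_

_⊖_ : ∀ {m} → V m → V m → V m
_⊖_ = zipWith _∸_

leqPW-head : ∀ x y {b} → T ((x ≤ᵇ y) ∧ b) → x ≤ y
leqPW-head x y p = ≤ᵇ⇒≤ x y (∧-elimˡ p)

leqPW-refl : ∀ {m} (v : V m) → T (leqPW v v)
leqPW-refl [] = tt
leqPW-refl (x ∷ v) = ∧-intro (≤⇒≤ᵇ (≤-refl {x})) (leqPW-refl v)

leqPW-trans : ∀ {m} (u v w : V m) → T (leqPW u v) → T (leqPW v w) → T (leqPW u w)
leqPW-trans [] [] [] _ _ = tt
leqPW-trans (x ∷ u) (y ∷ v) (z ∷ w) p q =
  ∧-intro (≤⇒≤ᵇ (≤-trans (leqPW-head x y p) (leqPW-head y z q))) (leqPW-trans u v w (∧-elimʳ p) (∧-elimʳ q))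

𝟎-leqPW : ∀ {m} (v : V m) → T (leqPW (𝟎 m) v)
𝟎-leqPW [] = tt
𝟎-leqPW (x ∷ v) = 𝟎-leqPW v

leqPW-𝟎⇒≡𝟎 : ∀ {m} (v : V m) → T (leqPW v (𝟎 m)) → v ≡ 𝟎 m
leqPW-𝟎⇒≡𝟎 [] _ = refl
leqPW-𝟎⇒≡𝟎 (x ∷ v) p with leqPW-head x 0 p
... | z≤n = cong (0 ∷_) (leqPW-𝟎⇒≡𝟎 v (∧-elimʳ p))

leqPW-⊕ : ∀ {m} (u v : V m) → T (leqPW u (u ⊕ v))
leqPW-⊕ [] [] = tt
leqPW-⊕ (x ∷ u) (y ∷ v) = ∧-intro (≤⇒≤ᵇ (m≤m+n x y)) (leqPW-⊕ u v)

leqPW-⊕-cancelˡ : ∀ {m} (u v w : V m) → leqPW (u ⊕ v) (u ⊕ w) ≡ leqPW v w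
leqPW-⊕-cancelˡ [] [] [] = refl
leqPW-⊕-cancelˡ (x ∷ u) (y ∷ v) (z ∷ w) = cong₂ _∧_ (+-cancelˡ-≤ᵇ x) (leqPW-⊕-cancelˡ u v w)
  where
  suc-≤ᵇ : ∀ p q → (suc p ≤ᵇ suc q) ≡ (p ≤ᵇ q)
  suc-≤ᵇ zero q = refl
  suc-≤ᵇ (suc p) q = refl
  +-cancelˡ-≤ᵇ : ∀ a → ((a + y) ≤ᵇ (a + z)) ≡ (y ≤ᵇ z)
  +-cancelˡ-≤ᵇ zero = refl
  +-cancelˡ-≤ᵇ (suc a) = trans (suc-≤ᵇ (a + y) (a + z)) (+-cancelˡ-≤ᵇ a)

leqPW-⊖-monoˡ : ∀ {m} (u v w : V m) → T (leqPW v w) → T (leqPW (v ⊖ u) (w ⊖ u))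
leqPW-⊖-monoˡ [] [] [] _ = tt
leqPW-⊖-monoˡ (x ∷ u) (y ∷ v) (z ∷ w) p =
  ∧-intro (≤⇒≤ᵇ (∸-monoˡ-≤ x (leqPW-head y z p))) (leqPW-⊖-monoˡ u v w (∧-elimʳ p))

leqPW-⊕-⊖ : ∀ {m} (u v w : V m) → T (leqPW u w) → T (leqPW v (w ⊖ u)) → T (leqPW (u ⊕ v) w)
leqPW-⊕-⊖ [] [] [] _ _ = tt
leqPW-⊕-⊖ (x ∷ u) (y ∷ v) (z ∷ w) p q =
  ∧-intro (≤⇒≤ᵇ (subst (x + y ≤_) (m+[n∸m]≡n (leqPW-head x z p)) (+-monoʳ-≤ x (leqPW-head y (z ∸ x) q))))
          (leqPW-⊕-⊖ u v w (∧-elimʳ p) (∧-elimʳ q))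

u⊕[v⊖u]≡v : ∀ {m} (u v : V m) → T (leqPW u v) → u ⊕ (v ⊖ u) ≡ v
u⊕[v⊖u]≡v [] [] _ = refl
u⊕[v⊖u]≡v (x ∷ u) (y ∷ v) p = cong₂ _∷_ (m+[n∸m]≡n (leqPW-head x y p)) (u⊕[v⊖u]≡v u v (∧-elimʳ p))

u⊕v⊖u≡v : ∀ {m} (u v : V m) → u ⊕ v ⊖ u ≡ v
u⊕v⊖u≡v [] [] = refl
u⊕v⊖u≡v (x ∷ u) (y ∷ v) = cong₂ _∷_ (m+n∸m≡n x y) (u⊕v⊖u≡v u v)

⊕-cancelˡ : ∀ {m} (u : V m) {v w} → u ⊕ v ≡ u ⊕ w → v ≡ w
⊕-cancelˡ u {v} {w} e = trans (sym (u⊕v⊖u≡v u v)) (trans (cong (_⊖ u) e) (u⊕v⊖u≡v u w))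

[u⊕v]⊖[u⊕w]≡v⊖w : ∀ {m} (u v w : V m) → (u ⊕ v) ⊖ (u ⊕ w) ≡ v ⊖ w
[u⊕v]⊖[u⊕w]≡v⊖w [] [] [] = refl
[u⊕v]⊖[u⊕w]≡v⊖w (x ∷ u) (y ∷ v) (z ∷ w) = cong₂ _∷_ ([m+n]∸[m+o]≡n∸o x y z) ([u⊕v]⊖[u⊕w]≡v⊖w u v w)

[w⊖u]⊖[v⊖u]≡w⊖v : ∀ {m} (u v w : V m) → T (leqPW u v) → (w ⊖ u) ⊖ (v ⊖ u) ≡ w ⊖ v
[w⊖u]⊖[v⊖u]≡w⊖v [] [] [] _ = refl
[w⊖u]⊖[v⊖u]≡w⊖v (x ∷ u) (y ∷ v) (z ∷ w) p =
  cong₂ _∷_ (trans (∸-+-assoc z x (y ∸ x)) (cong (z ∸_) (m+[n∸m]≡n (leqPW-head x y p))))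
            ([w⊖u]⊖[v⊖u]≡w⊖v u v w (∧-elimʳ p))

w⊖[u⊕v]≡w⊖u⊖v : ∀ {m} (u v w : V m) → w ⊖ (u ⊕ v) ≡ w ⊖ u ⊖ v
w⊖[u⊕v]≡w⊖u⊖v [] [] [] = refl
w⊖[u⊕v]≡w⊖u⊖v (x ∷ u) (y ∷ v) (z ∷ w) = cong₂ _∷_ (sym (∸-+-assoc z x y)) (w⊖[u⊕v]≡w⊖u⊖v u v w)

v⊕𝟎≡v : ∀ {m} (v : V m) → v ⊕ 𝟎 m ≡ v
v⊕𝟎≡v [] = refl
v⊕𝟎≡v (x ∷ v) = cong₂ _∷_ (+-identityʳ x) (v⊕𝟎≡v v)

v⊖𝟎≡v : ∀ {m} (v : V m) → v ⊖ 𝟎 m ≡ v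
v⊖𝟎≡v [] = refl
v⊖𝟎≡v (x ∷ v) = cong (x ∷_) (v⊖𝟎≡v v)

v⊖v≡𝟎 : ∀ {m} (v : V m) → v ⊖ v ≡ 𝟎 m
v⊖v≡𝟎 [] = refl
v⊖v≡𝟎 (x ∷ v) = cong₂ _∷_ (n∸n≡0 x) (v⊖v≡𝟎 v)

sum-⊕ : ∀ {m} (u v : V m) → sum (u ⊕ v) ≡ sum u + sum v
sum-⊕ [] [] = refl
sum-⊕ (x ∷ u) (y ∷ v) = trans (cong (x + y +_) (sum-⊕ u v)) (+-interchange x y (sum u) (sum v))

sum-⊖ : ∀ {m} (u v : V m) → T (leqPW u v) → sum u + sum (v ⊖ u) ≡ sum v
sum-⊖ u v p = trans (sym (sum-⊕ u (v ⊖ u))) (cong sum (u⊕[v⊖u]≡v u v p))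

sum-mono : ∀ {m} (u v : V m) → T (leqPW u v) → sum u ≤ sum v
sum-mono [] [] _ = z≤n
sum-mono (x ∷ u) (y ∷ v) p = +-mono-≤ (leqPW-head x y p) (sum-mono u v (∧-elimʳ p))

leqPW∧sum≡⇒≡ : ∀ {m} (u v : V m) → T (leqPW u v) → sum u ≡ sum v → u ≡ v
leqPW∧sum≡⇒≡ [] [] _ _ = refl
leqPW∧sum≡⇒≡ (x ∷ u) (y ∷ v) p e with m≤n⇒m<n∨m≡n (leqPW-head x y p)
... | inj₂ refl = cong (x ∷_) (leqPW∧sum≡⇒≡ u v (∧-elimʳ p) (+-cancelˡ-≡ x _ _ e))
... | inj₁ x<y = ⊥-elim (<⇒≢ (+-mono-<-≤ x<y (sum-mono u v (∧-elimʳ p))) e)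

sum≡0⇒≡𝟎 : ∀ {m} (v : V m) → sum v ≡ 0 → v ≡ 𝟎 m
sum≡0⇒≡𝟎 [] _ = refl
sum≡0⇒≡𝟎 (x ∷ v) e = cong₂ _∷_ (m+n≡0⇒m≡0 x e) (sum≡0⇒≡𝟎 v (m+n≡0⇒n≡0 x e))

sum-𝟎 : ∀ m → sum (𝟎 m) ≡ 0
sum-𝟎 zero = refl
sum-𝟎 (suc m) = sum-𝟎 m

sum-𝐣 : ∀ m → sum (𝐣 m) ≡ m
sum-𝐣 zero = refl
sum-𝐣 (suc m) = cong suc (sum-𝐣 m)

lookup≢1⇒≢𝐣 : ∀ {n} (v : V n) (i : Fin n) → Vec.lookup v i ≢ 1 → v ≢ 𝐣 n
lookup≢1⇒≢𝐣 v i ≢1 v≡𝐣 = ≢1 (trans (cong (λ w → Vec.lookup w i) v≡𝐣) (lookup-replicate i 1))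

𝟎≢𝐣 : ∀ m → 𝟎 (suc m) ≢ 𝐣 (suc m)
𝟎≢𝐣 m = lookup≢1⇒≢𝐣 (𝟎 (suc m)) zero (λ ())

inV⇒∣ : ∀ {n} (v : V n) → T (inV n v) → n ∣ sum v
inV⇒∣ {n} v p = toWitness {a? = n ∣? sum v} (∧-elimˡ p)

inV-intro : ∀ {n} (v : V n) → n ∣ sum v → v ≢ 𝐣 n → T (inV n v)
inV-intro {n} v n∣v v≢𝐣 = ∧-intro (fromWitness {a? = n ∣? sum v} n∣v) (≢⇒not-eqV v≢𝐣)

isAtom⇒sum≡ : ∀ {n} (b : V n) → T (isAtom n b) → sum b ≡ n
isAtom⇒sum≡ {n} b p = ≡ᵇ⇒≡ (sum b) n (∧-elimˡ p)

isAtom⇒inV : ∀ {n} (b : V n) → T (isAtom n b) → T (inV n b)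
isAtom⇒inV b p = inV-intro b (subst (_ ∣_) (sym (isAtom⇒sum≡ b p)) ∣-refl) (not-eqV⇒≢ (∧-elimʳ p))

isAtom-intro : ∀ {n} (b : V n) → sum b ≡ n → b ≢ 𝐣 n → T (isAtom n b)
isAtom-intro {n} b s b≢𝐣 = ∧-intro (≡⇒≡ᵇ (sum b) n s) (≢⇒not-eqV b≢𝐣)

𝟎⪯ : ∀ {n} (v : V n) → v ≢ 𝐣 n → T (leq n (𝟎 n) v)
𝟎⪯ v v≢𝐣 = ∧-intro (𝟎-leqPW v) (≢⇒not-eqV (subst (_≢ _) (sym (v⊖𝟎≡v v)) v≢𝐣))

⪯𝟎⇒≡𝟎 : ∀ {n} (v : V n) → T (leq n v (𝟎 n)) → v ≡ 𝟎 n
⪯𝟎⇒≡𝟎 v p = leqPW-𝟎⇒≡𝟎 v (∧-elimˡ p)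

leq-⊕-cancelˡ : ∀ {n} (u v w : V n) → leq n (u ⊕ v) (u ⊕ w) ≡ leq n v w
leq-⊕-cancelˡ {n} u v w =
  cong₂ (λ p d → p ∧ not (eqV d (𝐣 n))) (leqPW-⊕-cancelˡ u v w) ([u⊕v]⊖[u⊕w]≡v⊖w u w v)

≺-irrefl : ∀ {n} (x : V n) → ¬ strictLt n x x
≺-irrefl x (_ , x≢x) = x≢x refl

≺𝟎-empty : ∀ {n} (w : V n) → ¬ strictLt n w (𝟎 n)
≺𝟎-empty w (w⪯𝟎 , w≢𝟎) = w≢𝟎 (⪯𝟎⇒≡𝟎 w w⪯𝟎)

⊕-monoʳ-≺ : ∀ {n} (u : V n) {v w} → strictLt n v w → strictLt n (u ⊕ v) (u ⊕ w)
⊕-monoʳ-≺ u {v} {w} (v⪯w , v≢w) = subst T (sym (leq-⊕-cancelˡ u v w)) v⪯w , λ e → v≢w (⊕-cancelˡ u e)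

⊕-cancelˡ-≺ : ∀ {n} (u : V n) {v w} → strictLt n (u ⊕ v) (u ⊕ w) → strictLt n v w
⊕-cancelˡ-≺ u {v} {w} (v⪯w , v≢w) = subst T (leq-⊕-cancelˡ u v w) v⪯w , λ e → v≢w (cong (u ⊕_) e)

-- The only way b ⪯ x ⪯ y could fail to compose is y − b = 𝐣; as n ∣ sum x lies between
-- sum b = n and sum y = 2n, either x = b or x = y.
atom-⪯-trans : ∀ {m} (b x y : V (suc m)) → T (isAtom (suc m) b) → T (inV (suc m) x) →
               T (leq (suc m) b x) → T (leq (suc m) x y) → T (leq (suc m) b y)
atom-⪯-trans {m} b x y b-atom x∈V b⪯x x⪯y = ∧-intro b≤y (≢⇒not-eqV y⊖b≢𝐣)
  where
  n = suc m
  b≤x = ∧-elimˡ b⪯x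
  x≤y = ∧-elimˡ x⪯y
  b≤y = leqPW-trans b x y b≤x x≤y
  y⊖b≢𝐣 : y ⊖ b ≢ 𝐣 n
  y⊖b≢𝐣 y⊖b≡𝐣 with inV⇒∣ x x∈V
  ... | divides q sx = excluded q sx
    where
    sb = isAtom⇒sum≡ b b-atom
    sy : sum y ≡ n + n
    sy = trans (sym (sum-⊖ b y b≤y)) (cong₂ _+_ sb (trans (cong sum y⊖b≡𝐣) (sum-𝐣 n)))
    excluded : ∀ q → sum x ≡ q * n → ⊥
    excluded zero sx = <⇒≱ z<s (subst₂ _≤_ sb sx (sum-mono b x b≤x))
    excluded 1 sx with leqPW∧sum≡⇒≡ b x b≤x (trans sb (sym (trans sx (+-identityʳ n))))
    ... | refl = not-eqV⇒≢ (∧-elimʳ x⪯y) y⊖b≡𝐣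
    excluded 2 sx with leqPW∧sum≡⇒≡ x y x≤y (trans sx (trans (cong (n +_) (+-identityʳ n)) (sym sy)))
    ... | refl = not-eqV⇒≢ (∧-elimʳ b⪯x) y⊖b≡𝐣
    excluded (suc (suc (suc q))) sx =
      <⇒≱ (+-monoʳ-< n (m<m+n n z<s)) (subst₂ _≤_ sx sy (sum-mono x y x≤y))

AtomBelow : (n : ℕ) → V n → Set
AtomBelow n x = ∃ λ b → T (isAtom n b) × T (leq n b x)

greedy : ∀ {l} → ℕ → V l → V l
greedy t [] = []
greedy t (v ∷ vs) = (v ⊓ t) ∷ greedy (t ∸ v) vs

greedy-leqPW : ∀ {l} t (v : V l) → T (leqPW (greedy t v) v)
greedy-leqPW t [] = tt
greedy-leqPW t (v ∷ vs) = ∧-intro (≤⇒≤ᵇ (m⊓n≤m v t)) (greedy-leqPW (t ∸ v) vs)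

sum-greedy-0 : ∀ {l} (v : V l) → sum (greedy 0 v) ≡ 0
sum-greedy-0 [] = refl
sum-greedy-0 (v ∷ vs) rewrite ⊓-zeroʳ v | 0∸n≡0 v = sum-greedy-0 vs

sum-greedy : ∀ {l} t (v : V l) → t ≤ sum v → sum (greedy t v) ≡ t
sum-greedy zero [] _ = refl
sum-greedy t (v ∷ vs) t≤ with ≤-total t v
... | inj₁ t≤v rewrite m≥n⇒m⊓n≡n t≤v | m≤n⇒m∸n≡0 t≤v | sum-greedy-0 vs = +-identityʳ t
... | inj₂ v≤t rewrite m≤n⇒m⊓n≡m v≤t =
  trans (cong (v +_) (sum-greedy (t ∸ v) vs (subst (t ∸ v ≤_) (m+n∸m≡n v (sum vs)) (∸-monoˡ-≤ v t≤))))
        (m+[n∸m]≡n v≤t)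

module _ (k : ℕ) where
  private
    n : ℕ
    n = suc (suc (suc k))

  atomBelow-intro : (x b : V n) → sum b ≡ n → b ≢ 𝐣 n → T (leqPW b x) → x ⊖ b ≢ 𝐣 n → AtomBelow n x
  atomBelow-intro x b sb b≢𝐣 b≤x x⊖b≢𝐣 = b , isAtom-intro b sb b≢𝐣 , ∧-intro b≤x (≢⇒not-eqV x⊖b≢𝐣)

  n∸n≢1 : ∀ a → a ∸ a ≢ 1
  n∸n≢1 a e = 0≢1+n (trans (sym (n∸n≡0 a)) e)

  sum-[a,b,c,𝟎] : ∀ a b c → sum (a ∷ b ∷ c ∷ 𝟎 k) ≡ a + (b + c)
  sum-[a,b,c,𝟎] a b c = cong (λ t → a + (b + t)) (trans (cong (c +_) (sum-𝟎 k)) (+-identityʳ c))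

  -- Each b below has a zero entry, so b ≢ 𝐣, and x ⊖ b has an entry other than 1.
  atomBelow-greedy : ∀ x₁ x₂ x₃ r → x₁ ≤ n → n ≤ x₁ + (x₃ + sum r) → AtomBelow n (x₁ ∷ x₂ ∷ x₃ ∷ r)
  atomBelow-greedy x₁ x₂ x₃ r x₁≤n n≤x₁₃ᵣ =
    atomBelow-intro x b sb (lookup≢1⇒≢𝐣 b (suc zero) λ ()) b≤x (lookup≢1⇒≢𝐣 (x ⊖ b) zero (n∸n≢1 x₁))
    where
    x = x₁ ∷ x₂ ∷ x₃ ∷ r
    b = x₁ ∷ 0 ∷ greedy (n ∸ x₁) (x₃ ∷ r)
    sb : sum b ≡ n
    sb = trans (cong (x₁ +_) (sum-greedy (n ∸ x₁) (x₃ ∷ r)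
                 (subst (n ∸ x₁ ≤_) (m+n∸m≡n x₁ _) (∸-monoˡ-≤ x₁ n≤x₁₃ᵣ))))
               (m+[n∸m]≡n x₁≤n)
    b≤x : T (leqPW b x)
    b≤x = ∧-intro (≤⇒≤ᵇ (≤-refl {x₁})) (greedy-leqPW (n ∸ x₁) (x₃ ∷ r))

  atomBelow-second : ∀ x₁ x₂ x₃ r → n ≤ x₂ → x₃ ≤ n → AtomBelow n (x₁ ∷ x₂ ∷ x₃ ∷ r)
  atomBelow-second x₁ x₂ x₃ r n≤x₂ x₃≤n =
    atomBelow-intro x b sb (lookup≢1⇒≢𝐣 b zero λ ()) b≤x (lookup≢1⇒≢𝐣 (x ⊖ b) (suc (suc zero)) (n∸n≢1 x₃))
    where
    x = x₁ ∷ x₂ ∷ x₃ ∷ r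
    b = 0 ∷ (n ∸ x₃) ∷ x₃ ∷ 𝟎 k
    sb : sum b ≡ n
    sb = trans (sum-[a,b,c,𝟎] 0 (n ∸ x₃) x₃) (m∸n+n≡m x₃≤n)
    b≤x : T (leqPW b x)
    b≤x = ∧-intro tt (∧-intro (≤⇒≤ᵇ (≤-trans (m∸n≤m n x₃) n≤x₂)) (∧-intro (≤⇒≤ᵇ (≤-refl {x₃})) (𝟎-leqPW r)))

  atomBelow-first : ∀ x₁ x₂ x₃ r → n ≤ x₁ → x₃ ≤ n → AtomBelow n (x₁ ∷ x₂ ∷ x₃ ∷ r)
  atomBelow-first x₁ x₂ x₃ r n≤x₁ x₃≤n =
    atomBelow-intro x b sb (lookup≢1⇒≢𝐣 b (suc zero) λ ()) b≤x (lookup≢1⇒≢𝐣 (x ⊖ b) (suc (suc zero)) (n∸n≢1 x₃))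
    where
    x = x₁ ∷ x₂ ∷ x₃ ∷ r
    b = (n ∸ x₃) ∷ 0 ∷ x₃ ∷ 𝟎 k
    sb : sum b ≡ n
    sb = trans (sum-[a,b,c,𝟎] (n ∸ x₃) 0 x₃) (m∸n+n≡m x₃≤n)
    b≤x : T (leqPW b x)
    b≤x = ∧-intro (≤⇒≤ᵇ (≤-trans (m∸n≤m n x₃) n≤x₁)) (∧-intro tt (∧-intro (≤⇒≤ᵇ (≤-refl {x₃})) (𝟎-leqPW r)))

  atomBelow-first-third : ∀ x₁ x₂ x₃ r → n ≤ x₁ → n < x₃ → AtomBelow n (x₁ ∷ x₂ ∷ x₃ ∷ r)
  atomBelow-first-third x₁ x₂ x₃ r n≤x₁ n<x₃ =
    atomBelow-intro x b sb (lookup≢1⇒≢𝐣 b (suc zero) λ ()) b≤x (lookup≢1⇒≢𝐣 (x ⊖ b) (suc (suc zero)) x₃≢1)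
    where
    x = x₁ ∷ x₂ ∷ x₃ ∷ r
    b = n ∷ 0 ∷ 0 ∷ 𝟎 k
    sb : sum b ≡ n
    sb = trans (sum-[a,b,c,𝟎] n 0 0) (+-identityʳ n)
    b≤x : T (leqPW b x)
    b≤x = ∧-intro (≤⇒≤ᵇ n≤x₁) (∧-intro tt (∧-intro tt (𝟎-leqPW r)))
    x₃≢1 : x₃ ≢ 1
    x₃≢1 x₃≡1 = <⇒≱ n<x₃ (subst (_≤ n) (sym x₃≡1) (s≤s z≤n))

  atomBelow-large : (x : V n) → n + n ≤ sum x → AtomBelow n x
  atomBelow-large (x₁ ∷ x₂ ∷ x₃ ∷ r) 2n≤x with x₁ ≤? n | n ≤? x₁ + (x₃ + sum r) | x₃ ≤? n
  ... | yes x₁≤n | yes n≤x₁₃ᵣ | _        = atomBelow-greedy x₁ x₂ x₃ r x₁≤n n≤x₁₃ᵣ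
  ... | yes _    | no n≰x₁₃ᵣ | _        = atomBelow-second x₁ x₂ x₃ r n≤x₂ x₃≤n
    where
    x₁₃ᵣ<n : x₁ + (x₃ + sum r) < n
    x₁₃ᵣ<n = ≰⇒> n≰x₁₃ᵣ
    x₃≤n : x₃ ≤ n
    x₃≤n = ≤-trans (≤-trans (m≤m+n x₃ (sum r)) (m≤n+m _ x₁)) (<⇒≤ x₁₃ᵣ<n)
    n≤x₂ : n ≤ x₂
    n≤x₂ = <⇒≤ (+-cancelʳ-< n n x₂ (begin-strict
      n + n                    ≤⟨ 2n≤x ⟩
      x₁ + (x₂ + (x₃ + sum r)) ≡⟨ x+[y+z]≡y+[x+z] x₁ x₂ _ ⟩
      x₂ + (x₁ + (x₃ + sum r)) <⟨ +-monoʳ-< x₂ x₁₃ᵣ<n ⟩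
      x₂ + n                   ∎))
      where open ≤-Reasoning
  ... | no n≮x₁ | _          | yes x₃≤n = atomBelow-first x₁ x₂ x₃ r (<⇒≤ (≰⇒> n≮x₁)) x₃≤n
  ... | no n≮x₁ | _          | no x₃≰n  = atomBelow-first-third x₁ x₂ x₃ r (<⇒≤ (≰⇒> n≮x₁)) (≰⇒> x₃≰n)

atomBelow : ∀ {n} → 3 ≤ n → (x : V n) → T (inV n x) → x ≢ 𝟎 n → AtomBelow n x
atomBelow {n@(suc (suc (suc k)))} (s≤s (s≤s (s≤s _))) x x∈V x≢𝟎 with inV⇒∣ x x∈V
... | divides zero sx = ⊥-elim (x≢𝟎 (sum≡0⇒≡𝟎 x sx))
... | divides 1 sx =
  x , isAtom-intro x (trans sx (+-identityʳ n)) (not-eqV⇒≢ (∧-elimʳ x∈V)) ,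
  ∧-intro (leqPW-refl x) (≢⇒not-eqV (subst (_≢ 𝐣 n) (sym (v⊖v≡𝟎 x)) (𝟎≢𝐣 (suc (suc k)))))
... | divides (suc (suc q)) sx =
  atomBelow-large k x (subst (n + n ≤_) (sym sx) (+-monoʳ-≤ n (m≤m+n n (q * n))))

-- AL n k and AS n k unfold to firstAtoms n ltL k and firstAtoms n (ltS n) k.
firstAtoms : (n : ℕ) → (V n → V n → Bool) → ℕ → V n → Bool
firstAtoms n lt k b = isAtom n b ∧ (countBelow n (λ _ → true) lt b <ᵇ k)

lex-irrefl : ∀ s {b} → ¬ T b → ¬ T ((s <ᵇ s) ∨ ((s ≡ᵇ s) ∧ b))
lex-irrefl s ¬b p with Equivalence.to T-∨ p
... | inj₁ s<ᵇs = <-irrefl refl (<ᵇ⇒< s s s<ᵇs)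
... | inj₂ q = ¬b (∧-elimʳ q)

ltL-irrefl : ∀ {m} (v : V m) → ¬ T (ltL v v)
ltL-irrefl [] ()
ltL-irrefl (x ∷ v) = lex-irrefl x (ltL-irrefl v)

ltS-irrefl : ∀ n (v : V n) → ¬ T (ltS n v v)
ltS-irrefl n v = lex-irrefl (sBlock n v) (ltL-irrefl v)

atom∈atomList : ∀ n (b : V n) → T (isAtom n b) → b ∈ atomList n
atom∈atomList n b p = ∈-filter⁺ (T? ∘ isAtom n) (∈boxVecs n n b (≤-reflexive (isAtom⇒sum≡ b p))) p
  where
  ∈boxVecs : ∀ m c (v : V m) → sum v ≤ c → v ∈ boxVecs m c
  ∈boxVecs zero c [] _ = here refl
  ∈boxVecs (suc m) c (x ∷ v) x+v≤c =
    ∈-concatMap⁺ (λ y → map (y ∷_) (boxVecs m c))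
      (Any.map (λ { refl → ∈-map⁺ (x ∷_) (∈boxVecs m c v (≤-trans (m≤n+m (sum v) x) x+v≤c)) })
               (∈-upTo⁺ (s≤s (≤-trans (m≤m+n x (sum v)) x+v≤c))))

module _ (n : ℕ) (lt : V n → V n → Bool) where

  firstAtoms-all : (∀ b → ¬ T (lt b b)) → ∀ b → T (isAtom n b) → T (firstAtoms n lt (card-Aall n) b)
  firstAtoms-all irrefl b p =
    ∧-intro p (<⇒<ᵇ (filter-notAll (λ c → T? (lt c b)) (atomList n) (lose (atom∈atomList n b p) (irrefl b))))

  firstAtom⇒≡least : ∀ a → T (isAtom n a) → (∀ b → T (isAtom n b) → b ≢ a → T (lt a b)) →
                     ∀ b → T (firstAtoms n lt 1 b) → b ≡ a
  firstAtom⇒≡least a a-atom a-below b p with b ≟V a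
  ... | yes b≡a = b≡a
  ... | no b≢a = ⊥-elim (<ᵇ1⇒≯0 (∧-elimʳ p) (filter-some (λ c → T? (lt c b))
                   (lose (atom∈atomList n a a-atom) (a-below b (∧-elimˡ p) b≢a))))
    where
    <ᵇ1⇒≯0 : ∀ {c} → T (c <ᵇ 1) → ¬ (0 < c)
    <ᵇ1⇒≯0 {zero} _ ()

card-Aall-pos : ∀ n (a : V n) → T (isAtom n a) → 1 ≤ card-Aall n
card-Aall-pos n a p with atomList n | atom∈atomList n a p
... | _ ∷ _ | _ = s≤s z≤n

atLast : (m k : ℕ) → V (suc m)
atLast zero k = k ∷ []
atLast (suc m) k = 0 ∷ atLast m k

sum-atLast : ∀ m k → sum (atLast m k) ≡ k
sum-atLast zero k = +-identityʳ k
sum-atLast (suc m) k = sum-atLast m k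

lookup-atLast : ∀ m k → Vec.lookup (atLast m k) (fromℕ m) ≡ k
lookup-atLast zero k = refl
lookup-atLast (suc m) k = lookup-atLast m k

atLast-ltL : ∀ m k (b : V (suc m)) → sum b ≡ k → b ≢ atLast m k → T (ltL (atLast m k) b)
atLast-ltL zero k (x ∷ []) s b≢ = ⊥-elim (b≢ (cong (_∷ []) (trans (sym (+-identityʳ x)) s)))
atLast-ltL (suc m) k (zero ∷ b) s b≢ = atLast-ltL m k b s (λ e → b≢ (cong (0 ∷_) e))
atLast-ltL (suc m) k (suc x ∷ b) s b≢ = tt

-- (0,…,0,n): the <ᴸ-least atom, and for n ≥ 3 also the <ˢ-least one
𝐚 : (m : ℕ) → V (suc m)
𝐚 m = atLast m (suc m)

module _ {m : ℕ} (1≤m : 1 ≤ m) where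
  private
    n = suc m

  𝐚-atom : T (isAtom n (𝐚 m))
  𝐚-atom = isAtom-intro (𝐚 m) (sum-atLast m n)
             (lookup≢1⇒≢𝐣 (𝐚 m) (fromℕ m) (λ e → <⇒≢ (s≤s 1≤m) (sym (trans (sym (lookup-atLast m n)) e))))

  𝐚-<ᴸ : ∀ b → T (isAtom n b) → b ≢ 𝐚 m → T (ltL (𝐚 m) b)
  𝐚-<ᴸ b p = atLast-ltL m n b (isAtom⇒sum≡ b p)

  AL1⇒≡𝐚 : ∀ b → T (AL n 1 b) → b ≡ 𝐚 m
  AL1⇒≡𝐚 = firstAtom⇒≡least n ltL (𝐚 m) 𝐚-atom 𝐚-<ᴸ

u0-last : ∀ m → Vec.lookup (u0 (suc m)) (fromℕ m) ≡ 2
u0-last m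
  rewrite lookup∘tabulate (λ i → if suc (toℕ i) ≡ᵇ suc m then 2 else if suc (suc (toℕ i)) ≡ᵇ suc m then 0 else 1) (fromℕ m)
        | toℕ-fromℕ m | Equivalence.to T-≡ (≡⇒≡ᵇ m m refl) = refl

module _ {m : ℕ} (2≤m : 2 ≤ m) where
  private
    n = suc m
    1≤m = ≤-trans (s≤s z≤n) 2≤m

  𝐚-tailNZ : T (tailNZ n n (𝐚 m))
  𝐚-tailNZ = any⁺ _ (lose (∈-allFin (fromℕ m)) last-entry)
    where
    last-entry : T ((n ≤ᵇ suc (toℕ (fromℕ m))) ∧ not (Vec.lookup (𝐚 m) (fromℕ m) ≡ᵇ 0))
    last-entry rewrite toℕ-fromℕ m | lookup-atLast m n = ∧-intro (≤⇒≤ᵇ (≤-refl {n})) tt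

  𝐚≢u0 : 𝐚 m ≢ u0 n
  𝐚≢u0 e = <⇒≢ (s≤s 2≤m) (sym (trans (sym (lookup-atLast m n)) (trans (cong (λ v → Vec.lookup v (fromℕ m)) e) (u0-last m))))

  sBlock-𝐚 : sBlock n (𝐚 m) ≡ 0
  sBlock-𝐚 rewrite Equivalence.to T-≡ (∧-intro (∧-intro (𝐚-atom 1≤m) 𝐚-tailNZ) (≢⇒not-eqV 𝐚≢u0)) = refl

  𝐚-<ˢ : ∀ b → T (isAtom n b) → b ≢ 𝐚 m → T (ltS n (𝐚 m) b)
  𝐚-<ˢ b p b≢𝐚 rewrite sBlock-𝐚 with sBlock n b
  ... | zero = 𝐚-<ᴸ 1≤m b p b≢𝐚
  ... | suc _ = tt

  AS1⇒≡𝐚 : ∀ b → T (AS n 1 b) → b ≡ 𝐚 m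
  AS1⇒≡𝐚 = firstAtom⇒≡least n (ltS n) (𝐚 m) (𝐚-atom 1≤m) 𝐚-<ˢ

lookup-map : ∀ {A B : Set} (f : A → B) (xs : List A) (i : Fin (length (map f xs))) →
             lookup (map f xs) i ≡ f (lookup xs (cast (length-map f xs) i))
lookup-map f (x ∷ xs) zero = refl
lookup-map f (x ∷ xs) (suc i) = lookup-map f xs i

ExchangeCondition : ∀ {n} (P : V n → Set) (_≺_ : V n → V n → Set) → List (List (V n)) → Set
ExchangeCondition P _≺_ L =
  ∀ (i j : Fin (length L)) → toℕ i < toℕ j →
    Σ (Fin (length L)) λ k → toℕ k < toℕ j
      × (∀ x → x ∈ lookup L j → x ∈ lookup L i → x ∈ lookup L k)
      × symDiffSize P _≺_ (lookup L j) (lookup L k) ≡ 2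

module _ {n : ℕ} {_≺_ : V n → V n → Set} where

  MaxChain-resp-≐ : ∀ {P Q c} → P ≐ Q → MaxChain P _≺_ c → MaxChain Q _≺_ c
  MaxChain-resp-≐ (P⊆Q , Q⊆P) ((c⊆P , sorted) , maximal) =
    ((λ x x∈c → P⊆Q (c⊆P x x∈c)) , sorted) , (λ x Qx → maximal x (Q⊆P Qx))

  ShellableWrt-resp-≐ : ∀ {P Q lt} → P ≐ Q → ShellableWrt P _≺_ lt → ShellableWrt Q _≺_ lt
  ShellableWrt-resp-≐ P≐Q (L , (maximal , complete , unique , shelling) , atom-order) =
    L , ( (λ c c∈L → MaxChain-resp-≐ P≐Q (maximal c c∈L))
        , (λ c max → complete c (MaxChain-resp-≐ (swap P≐Q) max))
        , unique , shelling)
      , atom-order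

  module _ {P : V n → Set} {o : V n} (Po : P o) (nothing-below-o : ∀ w → ¬ (w ≺ o))
           (o-below : ∀ x → P x → x ≢ o → o ≺ x) where

    MaxChain-head : ∀ c → MaxChain P _≺_ c → ∃ λ c′ → c ≡ o ∷ c′
    MaxChain-head c ((c⊆P , sorted) , maximal) = starts-at-o c sorted o∈c
      where
      open import Data.List.Membership.DecPropositional (_≟V_ {n}) using (_∈?_)
      o∈c : o ∈ c
      o∈c with o ∈? c
      ... | yes o∈c = o∈c
      ... | no o∉c = maximal o Po (λ y y∈c → inj₁ (o-below y (c⊆P y y∈c) (λ y≡o → o∉c (subst (_∈ c) y≡o y∈c))))
      starts-at-o : ∀ d → AllPairs _≺_ d → o ∈ d → ∃ λ d′ → d ≡ o ∷ d′
      starts-at-o (w ∷ d) _ (here refl) = d , refl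
      starts-at-o (w ∷ d) (w≺d ∷ _) (there o∈d) = ⊥-elim (nothing-below-o w (All.lookup w≺d o∈d))

  singleton-shellable : ∀ {P o} lt → (∀ x → ¬ (x ≺ x)) → P ≐ (_≡ o) → ShellableWrt P _≺_ lt
  singleton-shellable {P} {o} lt irrefl (P⊆o , o⊆P) = (o ∷ []) ∷ [] , (maximal , complete , All.[] ∷ [] , shelling) , atom-order
    where
    maximal : ∀ c → c ∈ (o ∷ []) ∷ [] → MaxChain P _≺_ c
    maximal c (here refl) = ((λ { x (here refl) → o⊆P refl }) , All.[] ∷ []) , (λ x Px _ → here (P⊆o Px))
    complete : ∀ c → MaxChain P _≺_ c → c ∈ (o ∷ []) ∷ []
    complete [] (_ , maximal) with maximal o (o⊆P refl) (λ y ())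
    ... | ()
    complete (w ∷ []) ((c⊆P , _) , _) = here (cong (_∷ []) (P⊆o (c⊆P w (here refl))))
    complete (w ∷ w′ ∷ _) ((c⊆P , (w≺ ∷ _)) , _) =
      ⊥-elim (irrefl o (subst₂ _≺_ (P⊆o (c⊆P w (here refl))) (P⊆o (c⊆P w′ (there (here refl)))) (All.head w≺)))
    shelling : ∀ (i j : Fin 1) → toℕ i < toℕ j → _
    shelling zero zero ()
    atom-order : ∀ (i j : Fin 1) a′ a → _ → _ → T (lt a′ a) → toℕ i < toℕ j
    atom-order zero zero _ _ () _ _

-- Below the image of an order embedding φ, a new bottom o is attached.  Every maximal chain of
-- the result is o ≺ φ o ≺ …, so all of them have the same atom φ o and the order on atoms
-- imposes nothing.
module Cone {n : ℕ} {P : V n → Set} {_≺_ : V n → V n → Set} {o : V n} (φ ψ : V n → V n)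
  (Po : P o) (irrefl : ∀ x → ¬ (x ≺ x)) (nothing-below-o : ∀ w → ¬ (w ≺ o))
  (o-below : ∀ x → P x → x ≢ o → o ≺ x) (o-below-φ : ∀ x → P x → o ≺ φ x) (φ≢o : ∀ x → φ x ≢ o)
  (ψ∘φ : ∀ x → ψ (φ x) ≡ x) (φ-mono : ∀ {x y} → x ≺ y → φ x ≺ φ y) (φ-reflects : ∀ {x y} → φ x ≺ φ y → x ≺ y)
  where

  open import Data.List.Membership.DecPropositional (_≟V_ {n}) using (_∈?_)

  ConeP : V n → Set
  ConeP w = w ≡ o ⊎ ∃ λ x → P x × w ≡ φ x

  lift : List (V n) → List (V n)
  lift c = o ∷ map φ c

  φ-injective : ∀ {x y} → φ x ≡ φ y → x ≡ y
  φ-injective {x} {y} e = trans (sym (ψ∘φ x)) (trans (cong ψ e) (ψ∘φ y))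

  lift-injective : ∀ {c d} → lift c ≡ lift d → c ≡ d
  lift-injective e = map-injective φ-injective (∷-injectiveʳ e)

  ∈-lift⁻ : ∀ {u c} → φ u ∈ lift c → u ∈ c
  ∈-lift⁻ (here φu≡o) = ⊥-elim (φ≢o _ φu≡o)
  ∈-lift⁻ {c = c} (there p) with ∈-map⁻ φ p
  ... | v , v∈c , φu≡φv = subst (_∈ c) (sym (φ-injective φu≡φv)) v∈c

  MaxChain-lift : ∀ c → MaxChain P _≺_ c → MaxChain ConeP _≺_ (lift c)
  MaxChain-lift c ((c⊆P , sorted) , maximal) = (lift⊆Cone , lift-sorted) , lift-maximal
    where
    lift⊆Cone : ∀ x → x ∈ lift c → ConeP x
    lift⊆Cone x (here refl) = inj₁ refl
    lift⊆Cone x (there p) with ∈-map⁻ φ p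
    ... | u , u∈c , x≡φu = inj₂ (u , c⊆P u u∈c , x≡φu)
    lift-sorted : AllPairs _≺_ (lift c)
    lift-sorted = All.map⁺ (All.tabulate (λ {u} u∈c → o-below-φ u (c⊆P u u∈c)))
                ∷ AllPairs.map⁺ (AllPairs.map φ-mono sorted)
    lift-maximal : ∀ x → ConeP x → (∀ y → y ∈ lift c → (x ≺ y) ⊎ (y ≺ x)) → x ∈ lift c
    lift-maximal x (inj₁ refl) _ = here refl
    lift-maximal x (inj₂ (u , Pu , refl)) comparable = there (∈-map⁺ φ (maximal u Pu comparable-u))
      where
      comparable-u : ∀ y → y ∈ c → (u ≺ y) ⊎ (y ≺ u)
      comparable-u y y∈c with comparable (φ y) (there (∈-map⁺ φ y∈c))
      ... | inj₁ φu≺φy = inj₁ (φ-reflects φu≺φy)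
      ... | inj₂ φy≺φu = inj₂ (φ-reflects φy≺φu)

  map-preimage : ∀ xs → (∀ w → w ∈ xs → ∃ λ u → P u × w ≡ φ u) →
                 Σ (List (V n)) λ c → map φ c ≡ xs × (∀ u → u ∈ c → P u)
  map-preimage [] _ = [] , refl , λ _ ()
  map-preimage (w ∷ xs) xs⊆φP with xs⊆φP w (here refl) | map-preimage xs (λ v p → xs⊆φP v (there p))
  ... | u , Pu , refl | c , refl , c⊆P = u ∷ c , refl , λ { v (here refl) → Pu ; v (there p) → c⊆P v p }

  MaxChain-lift⁻ : ∀ d → MaxChain ConeP _≺_ d → Σ (List (V n)) λ c → MaxChain P _≺_ c × d ≡ lift c
  MaxChain-lift⁻ d max with MaxChain-head {P = ConeP} (inj₁ refl) nothing-below-o o-below′ d max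
    where
    o-below′ : ∀ x → ConeP x → x ≢ o → o ≺ x
    o-below′ x (inj₁ x≡o) x≢o = ⊥-elim (x≢o x≡o)
    o-below′ x (inj₂ (u , Pu , refl)) _ = o-below-φ u Pu
  MaxChain-lift⁻ .(o ∷ d′) ((d⊆Cone , (o≺d′ ∷ sorted)) , maximal) | d′ , refl with map-preimage d′ d′⊆φP
    where
    d′⊆φP : ∀ w → w ∈ d′ → ∃ λ u → P u × w ≡ φ u
    d′⊆φP w w∈d′ with d⊆Cone w (there w∈d′)
    ... | inj₁ refl = ⊥-elim (irrefl o (All.lookup o≺d′ w∈d′))
    ... | inj₂ w∈φP = w∈φP
  ... | c , refl , c⊆P = c , ((c⊆P , AllPairs.map φ-reflects (AllPairs.map⁻ sorted)) , c-maximal) , refl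
    where
    c-maximal : ∀ x → P x → (∀ y → y ∈ c → (x ≺ y) ⊎ (y ≺ x)) → x ∈ c
    c-maximal x Px comparable = ∈-lift⁻ (maximal (φ x) (inj₂ (x , Px , refl)) comparable-φx)
      where
      comparable-φx : ∀ y → y ∈ lift c → (φ x ≺ y) ⊎ (y ≺ φ x)
      comparable-φx y (here refl) = inj₂ (o-below-φ x Px)
      comparable-φx y (there p) with ∈-map⁻ φ p
      ... | v , v∈c , refl with comparable v v∈c
      ... | inj₁ x≺v = inj₁ (φ-mono x≺v)
      ... | inj₂ v≺x = inj₂ (φ-mono v≺x)

  -- symDiffSize c d ≡ missing c d + missing d c
  missing : List (V n) → List (V n) → ℕ
  missing c d = length (filterᵇ (λ x → not ⌊ x ∈? d ⌋) c)

  missing-lift : ∀ c d → missing (lift c) (lift d) ≡ missing c d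
  missing-lift c d with o ∈? lift d
  ... | no o∉ = ⊥-elim (o∉ (here refl))
  ... | yes _ = length-filter-map c
    where
    ∈?-lift : ∀ u → ⌊ φ u ∈? lift d ⌋ ≡ ⌊ u ∈? d ⌋
    ∈?-lift u with φ u ∈? lift d | u ∈? d
    ... | yes _ | yes _ = refl
    ... | no _ | no _ = refl
    ... | no φu∉ | yes u∈d = ⊥-elim (φu∉ (there (∈-map⁺ φ u∈d)))
    ... | yes φu∈ | no u∉d = ⊥-elim (u∉d (∈-lift⁻ φu∈))
    length-filter-map : ∀ c → length (filterᵇ (λ x → not ⌊ x ∈? lift d ⌋) (map φ c)) ≡ missing c d
    length-filter-map [] = refl
    length-filter-map (u ∷ c) rewrite ∈?-lift u with ⌊ u ∈? d ⌋
    ... | true = length-filter-map c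
    ... | false = cong suc (length-filter-map c)

  ∩-lift : ∀ ci cj ck → (∀ x → x ∈ cj → x ∈ ci → x ∈ ck) → ∀ x → x ∈ lift cj → x ∈ lift ci → x ∈ lift ck
  ∩-lift ci cj ck cj∩ci⊆ck x (here refl) _ = here refl
  ∩-lift ci cj ck cj∩ci⊆ck x (there p) x∈ci with ∈-map⁻ φ p
  ... | u , u∈cj , refl = there (∈-map⁺ φ (cj∩ci⊆ck u u∈cj (∈-lift⁻ x∈ci)))

  lookup-lift : ∀ L i → lookup (map lift L) i ≡ lift (lookup L (cast (length-map lift L) i))
  lookup-lift = lookup-map lift

  ExchangeCondition-lift : ∀ L → ExchangeCondition P _≺_ L → ExchangeCondition ConeP _≺_ (map lift L)
  ExchangeCondition-lift L exchange i j i<j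
    with exchange (cast (length-map lift L) i) (cast (length-map lift L) j)
                  (subst₂ _<_ (sym (toℕ-cast _ i)) (sym (toℕ-cast _ j)) i<j)
  ... | k , k<j , ∩⊆k , Δ≡2 = cast (sym e) k , k′<j , ∩⊆k′ , Δ′≡2
    where
    e = length-map lift L
    L′ = map lift L
    k′ = cast (sym e) k
    cj = lookup L (cast e j)
    ck = lookup L k
    lookup-k′ : lookup L′ k′ ≡ lift ck
    lookup-k′ = trans (lookup-lift L k′) (cong (λ t → lift (lookup L t)) (cast-involutive e (sym e) k))
    k′<j : toℕ k′ < toℕ j
    k′<j = subst₂ _<_ (sym (toℕ-cast (sym e) k)) (toℕ-cast e j) k<j
    ∩⊆k′ : ∀ x → x ∈ lookup L′ j → x ∈ lookup L′ i → x ∈ lookup L′ k′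
    ∩⊆k′ x x∈j x∈i = subst (x ∈_) (sym lookup-k′)
      (∩-lift _ cj ck ∩⊆k x (subst (x ∈_) (lookup-lift L j) x∈j) (subst (x ∈_) (lookup-lift L i) x∈i))
    Δ′≡2 : symDiffSize ConeP _≺_ (lookup L′ j) (lookup L′ k′) ≡ 2
    Δ′≡2 = begin
      symDiffSize ConeP _≺_ (lookup L′ j) (lookup L′ k′)        ≡⟨ cong₂ (symDiffSize ConeP _≺_) (lookup-lift L j) lookup-k′ ⟩
      missing (lift cj) (lift ck) + missing (lift ck) (lift cj) ≡⟨ cong₂ _+_ (missing-lift cj ck) (missing-lift ck cj) ⟩
      symDiffSize P _≺_ cj ck                                   ≡⟨ Δ≡2 ⟩
      2                                                         ∎
      where open ≡-Reasoning

  atomOf-lift : ∀ L → (∀ c → c ∈ L → MaxChain P _≺_ c) → ∀ i → atomOf ConeP _≺_ (lookup (map lift L) i) ≡ just (φ o)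
  atomOf-lift L maximal i
    with MaxChain-head Po nothing-below-o o-below _ (maximal _ (∈-lookup (cast (length-map lift L) i)))
  ... | c′ , c≡o∷c′ = cong (atomOf ConeP _≺_) (trans (lookup-lift L i) (cong lift c≡o∷c′))

  cone-shellable : ∀ {lt lt′} → ¬ T (lt′ (φ o) (φ o)) → ShellableWrt P _≺_ lt → ShellableWrt ConeP _≺_ lt′
  cone-shellable {lt′ = lt′} lt′-irrefl (L , (maximal , complete , unique , exchange) , _) =
    map lift L , (maximal′ , complete′ , Unique.map⁺ lift-injective unique , ExchangeCondition-lift L exchange) , atom-order′
    where
    maximal′ : ∀ c → c ∈ map lift L → MaxChain ConeP _≺_ c
    maximal′ c c∈L′ with ∈-map⁻ lift c∈L′
    ... | c₀ , c₀∈L , refl = MaxChain-lift c₀ (maximal c₀ c₀∈L)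
    complete′ : ∀ c → MaxChain ConeP _≺_ c → c ∈ map lift L
    complete′ c max with MaxChain-lift⁻ c max
    ... | c₀ , max₀ , refl = ∈-map⁺ lift (complete c₀ max₀)
    atom-order′ : ∀ (i j : Fin (length (map lift L))) (a′ a : V n) →
                  atomOf ConeP _≺_ (lookup (map lift L) i) ≡ just a′ → atomOf ConeP _≺_ (lookup (map lift L) j) ≡ just a →
                  T (lt′ a′ a) → toℕ i < toℕ j
    atom-order′ i j a′ a atom-i atom-j a′<a
      with just-injective (trans (sym (atomOf-lift L maximal i)) atom-i)
         | just-injective (trans (sym (atomOf-lift L maximal j)) atom-j)
    ... | refl | refl = ⊥-elim (lt′-irrefl a′<a)

module _ {m : ℕ} where
  private
    n : ℕ
    n = suc m

  atom⊕≢𝐣 : ∀ a x → T (isAtom n a) → a ⊕ x ≢ 𝐣 n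
  atom⊕≢𝐣 a x a-atom a⊕x≡𝐣 = not-eqV⇒≢ (∧-elimʳ a-atom)
    (leqPW∧sum≡⇒≡ a (𝐣 n) (subst (λ v → T (leqPW a v)) a⊕x≡𝐣 (leqPW-⊕ a x))
                  (trans (isAtom⇒sum≡ a a-atom) (sym (sum-𝐣 n))))

  atom⊕≢𝟎 : ∀ a x → T (isAtom n a) → a ⊕ x ≢ 𝟎 n
  atom⊕≢𝟎 a x a-atom a⊕x≡𝟎 = 0≢1+n (trans (sym (sum-𝟎 n)) (trans (cong sum (sym a≡𝟎)) (isAtom⇒sum≡ a a-atom)))
    where
    a≡𝟎 : a ≡ 𝟎 n
    a≡𝟎 = leqPW-𝟎⇒≡𝟎 a (subst (λ v → T (leqPW a v)) a⊕x≡𝟎 (leqPW-⊕ a x))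

  𝟎∈[𝟎,_] : ∀ y → T (inV n y) → inI n y (𝟎 n)
  𝟎∈[𝟎, y ] y∈V = inV-intro (𝟎 n) (subst (n ∣_) (sym (sum-𝟎 n)) (divides 0 refl)) (𝟎≢𝐣 m)
                , 𝟎⪯ (𝟎 n) (𝟎≢𝐣 m) , 𝟎⪯ y (not-eqV⇒≢ (∧-elimʳ y∈V))

  module Translation {a z : V n} (a-atom : T (isAtom n a)) (a⪯z : T (leq n a z)) where
    private
      a≤z : T (leqPW a z)
      a≤z = ∧-elimˡ a⪯z
      sum-z : sum z ≡ n + sum (z ⊖ a)
      sum-z = trans (sym (sum-⊖ a z a≤z)) (cong (_+ sum (z ⊖ a)) (isAtom⇒sum≡ a a-atom))

    n∣⊖atom : ∀ w → T (leqPW a w) → n ∣ sum w → n ∣ sum (w ⊖ a)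
    n∣⊖atom w a≤w n∣w = ∣m+n∣m⇒∣n (subst (n ∣_) sum-w n∣w) ∣-refl
      where
      sum-w : sum w ≡ n + sum (w ⊖ a)
      sum-w = trans (sym (sum-⊖ a w a≤w)) (cong (_+ sum (w ⊖ a)) (isAtom⇒sum≡ a a-atom))

    ⊖atom-inV : T (inV n z) → T (inV n (z ⊖ a))
    ⊖atom-inV z∈V = inV-intro (z ⊖ a) (n∣⊖atom z a≤z (inV⇒∣ z z∈V)) (not-eqV⇒≢ (∧-elimʳ a⪯z))

    rk-⊖atom : rk n (z ⊖ a) < rk n z
    rk-⊖atom = begin-strict
      sum (z ⊖ a) / n             <⟨ n<1+n _ ⟩
      suc (sum (z ⊖ a) / n)       ≡⟨ cong (λ t → suc (t / n)) (m+n∸m≡n n (sum (z ⊖ a))) ⟨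
      suc ((n + sum (z ⊖ a) ∸ n) / n) ≡⟨ m/n≡1+[m∸n]/n (m≤m+n n (sum (z ⊖ a))) ⟨
      (n + sum (z ⊖ a)) / n       ≡⟨ cong (_/ n) sum-z ⟨
      sum z / n                   ∎
      where open ≤-Reasoning

    ⊕atom-∈I : ∀ x → inI n (z ⊖ a) x → inI n z (a ⊕ x)
    ⊕atom-∈I x (x∈V , _ , x⪯z⊖a) =
      inV-intro (a ⊕ x) (subst (n ∣_) (sym sum-a⊕x) (∣m∣n⇒∣m+n ∣-refl (inV⇒∣ x x∈V))) (atom⊕≢𝐣 a x a-atom) ,
      𝟎⪯ (a ⊕ x) (atom⊕≢𝐣 a x a-atom) ,
      ∧-intro (leqPW-⊕-⊖ a x z a≤z (∧-elimˡ x⪯z⊖a))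
              (≢⇒not-eqV (subst (_≢ 𝐣 n) (sym (w⊖[u⊕v]≡w⊖u⊖v a x z)) (not-eqV⇒≢ (∧-elimʳ x⪯z⊖a))))
      where
      sum-a⊕x : sum (a ⊕ x) ≡ n + sum x
      sum-a⊕x = trans (sum-⊕ a x) (cong (_+ sum x) (isAtom⇒sum≡ a a-atom))

    atom⪯⊕ : ∀ x → T (inV n x) → T (leq n a (a ⊕ x))
    atom⪯⊕ x x∈V = ∧-intro (leqPW-⊕ a x) (≢⇒not-eqV (subst (_≢ 𝐣 n) (sym (u⊕v⊖u≡v a x)) (not-eqV⇒≢ (∧-elimʳ x∈V))))

    ⊖atom-∈I : ∀ w → inI n z w → T (leq n a w) → inI n (z ⊖ a) (w ⊖ a)
    ⊖atom-∈I w (w∈V , _ , w⪯z) a⪯w =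
      inV-intro (w ⊖ a) (n∣⊖atom w a≤w (inV⇒∣ w w∈V)) w⊖a≢𝐣 ,
      𝟎⪯ (w ⊖ a) w⊖a≢𝐣 ,
      ∧-intro (leqPW-⊖-monoˡ a w z (∧-elimˡ w⪯z))
              (≢⇒not-eqV (subst (_≢ 𝐣 n) (sym ([w⊖u]⊖[v⊖u]≡w⊖v a w z a≤w)) (not-eqV⇒≢ (∧-elimʳ w⪯z))))
      where
      a≤w : T (leqPW a w)
      a≤w = ∧-elimˡ a⪯w
      w⊖a≢𝐣 : w ⊖ a ≢ 𝐣 n
      w⊖a≢𝐣 = not-eqV⇒≢ (∧-elimʳ a⪯w)

  atom∈I : ∀ y b → T (isAtom n b) → T (leq n b y) → inI n y b
  atom∈I y b b-atom b⪯y = isAtom⇒inV b b-atom , 𝟎⪯ b (not-eqV⇒≢ (∧-elimʳ b-atom)) , b⪯y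

  module _ (3≤n : 3 ≤ n) {y : V n} (y∈V : T (inV n y)) where

    -- every element other than 𝟎 lies above some atom
    interval-≐ : inSub n y (AL n (card-Aall n)) ≐ inI n y
    interval-≐ = (λ { (inj₁ refl) → 𝟎∈[𝟎, y ] y∈V ; (inj₂ (x∈I , _)) → x∈I }) , covered
      where
      covered : ∀ {x} → inI n y x → inSub n y (AL n (card-Aall n)) x
      covered {x} x∈I with x ≟V 𝟎 n
      ... | yes x≡𝟎 = inj₁ x≡𝟎
      ... | no x≢𝟎 with atomBelow 3≤n x (proj₁ x∈I) x≢𝟎
      ... | b , b-atom , b⪯x =
        inj₂ (x∈I , b , firstAtoms-all n ltL ltL-irrefl b b-atom ,
              atom∈I y b b-atom (atom-⪯-trans b x y b-atom (proj₁ x∈I) b⪯x (proj₂ (proj₂ x∈I))) , b⪯x)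

    interval-shellable : (NonEmptyAt n y (AL n (card-Aall n)) → LShellable n y (AL n (card-Aall n))) →
                         ShellableWrt (inI n y) (strictLt n) ltL
    interval-shellable shellable with y ≟V 𝟎 n
    ... | yes refl = singleton-shellable ltL ≺-irrefl
                       ((λ x∈I → ⪯𝟎⇒≡𝟎 _ (proj₂ (proj₂ x∈I))) , λ { refl → 𝟎∈[𝟎, 𝟎 n ] y∈V })
    ... | no y≢𝟎 with atomBelow 3≤n y y∈V y≢𝟎
    ... | b , b-atom , b⪯y =
      ShellableWrt-resp-≐ interval-≐ (shellable (b , firstAtoms-all n ltL ltL-irrefl b b-atom , atom∈I y b b-atom b⪯y))

  atom-cone-shellable : ∀ {z a} (B : V n → Bool) lt → T (isAtom n a) → T (inV n z) → inI n z a → T (B a) →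
                        (∀ b → T (B b) → inI n z b → b ≡ a) → ¬ T (lt a a) →
                        (∀ y → T (inV n y) → rk n y < rk n z → ShellableWrt (inI n y) (strictLt n) ltL) →
                        ShellableWrt (inSub n z B) (strictLt n) lt
  atom-cone-shellable {z} {a} B lt a-atom z∈V a∈I Ba B-only-a lt-irrefl shellable-below =
    ShellableWrt-resp-≐ cone≐
      (cone-shellable (subst (λ v → ¬ T (lt v v)) (sym (v⊕𝟎≡v a)) lt-irrefl)
                      (shellable-below (z ⊖ a) (⊖atom-inV z∈V) rk-⊖atom))
    where
    a⪯z : T (leq n a z)
    a⪯z = proj₂ (proj₂ a∈I)
    open Translation {a} {z} a-atom a⪯z
    open Cone {P = inI n (z ⊖ a)} {_≺_ = strictLt n} {o = 𝟎 n} (a ⊕_) (_⊖ a)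
      (𝟎∈[𝟎, z ⊖ a ] (⊖atom-inV z∈V))
      ≺-irrefl ≺𝟎-empty
      (λ x x∈I x≢𝟎 → proj₁ (proj₂ x∈I) , λ 𝟎≡x → x≢𝟎 (sym 𝟎≡x))
      (λ x _ → 𝟎⪯ (a ⊕ x) (atom⊕≢𝐣 a x a-atom) , λ 𝟎≡a⊕x → atom⊕≢𝟎 a x a-atom (sym 𝟎≡a⊕x))
      (λ x → atom⊕≢𝟎 a x a-atom)
      (u⊕v⊖u≡v a)
      (⊕-monoʳ-≺ a) (⊕-cancelˡ-≺ a)
    cone≐ : ConeP ≐ inSub n z B
    cone≐ = (λ { (inj₁ w≡𝟎) → inj₁ w≡𝟎
               ; (inj₂ (x , x∈I , refl)) → inj₂ (⊕atom-∈I x x∈I , a , Ba , a∈I , atom⪯⊕ x (proj₁ x∈I)) })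
          , (λ { (inj₁ w≡𝟎) → inj₁ w≡𝟎
               ; (inj₂ (w∈I , b , Bb , b∈I , b⪯w)) → above-a w∈I (subst (λ v → T (leq n v _)) (B-only-a b Bb b∈I) b⪯w) })
      where
      above-a : ∀ {w} → inI n z w → T (leq n a w) → ConeP w
      above-a {w} w∈I a⪯w = inj₂ (w ⊖ a , ⊖atom-∈I w w∈I a⪯w , sym (u⊕[v⊖u]≡v a w (∧-elimˡ a⪯w)))

module _ {m : ℕ} (2≤m : 2 ≤ m) where
  private
    n : ℕ
    n = suc m
    K : ℕ
    K = card-Aall n
    3≤n : 3 ≤ n
    3≤n = s≤s 2≤m
    1≤m : 1 ≤ m
    1≤m = ≤-trans (s≤s z≤n) 2≤m

  first-atom-shellable : ∀ {z} (B : V n → Bool) lt → (∀ b → T (B b) → b ≡ 𝐚 m) → ¬ T (lt (𝐚 m) (𝐚 m)) →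
    T (inV n z) →
    (∀ y → T (inV n y) → rk n y < rk n z → NonEmptyAt n y (AL n K) → LShellable n y (AL n K)) →
    NonEmptyAt n z B → ShellableWrt (inSub n z B) (strictLt n) lt
  first-atom-shellable B lt B⇒𝐚 lt-irrefl z∈V shellable-below (b , Bb , b∈I) with B⇒𝐚 b Bb
  ... | refl = atom-cone-shellable B lt (𝐚-atom 1≤m) z∈V b∈I Bb (λ b′ Bb′ _ → B⇒𝐚 b′ Bb′) lt-irrefl
                 (λ y y∈V y<z → interval-shellable 3≤n y∈V (shellable-below y y∈V y<z))

lemma1 : (n : ℕ) → 4 ≤ n → (z : V n) → T (inV n z) →
    ((y : V n) → T (inV n y) → rk n y < rk n z →
        ((k : ℕ) → 1 ≤ k → k ≤ card-Aall n →
            (NonEmptyAt n y (AL n k) → LShellable n y (AL n k))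
          × (NonEmptyAt n y (AS n k) → SShellable n y (AS n k)))
      × ((ℓ : ℕ) → 1 ≤ ℓ → ℓ ≤ n ∸ 1 → (k : ℕ) → 1 ≤ k → k ≤ card-Aℓ n (ℓ + 1) →
            LShellable n y (Aℓk n (ℓ + 1) k))) →
    (NonEmptyAt n z (AL n 1) → LShellable n z (AL n 1))
      × (NonEmptyAt n z (AS n 1) → SShellable n z (AS n 1))
lemma1 (suc m) (s≤s 3≤m) z z∈V hyp =
  first-atom-shellable 2≤m (AL (suc m) 1) ltL (AL1⇒≡𝐚 1≤m) (ltL-irrefl (𝐚 m)) z∈V shellable-below ,
  first-atom-shellable 2≤m (AS (suc m) 1) (ltS (suc m)) (AS1⇒≡𝐚 2≤m) (ltS-irrefl (suc m) (𝐚 m)) z∈V shellable-below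
  where
  2≤m = ≤-trans (n≤1+n 2) 3≤m
  1≤m = ≤-trans (n≤1+n 1) 2≤m
  K≥1 = card-Aall-pos (suc m) (𝐚 m) (𝐚-atom 1≤m)
  shellable-below = λ y y∈V y<z → proj₁ (proj₁ (hyp y y∈V y<z) (card-Aall (suc m)) K≥1 ≤-refl)
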